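{- If there exists a Kirkman triple system of order $v$ which contains as a subdesign a Steiner triple system of order $u$, then there exists a Kirkman triple system of order $3v$ which contains as a subdesign a Steiner triple system of order $3u$.
   Context: An STS$(v)$ is a set of $v$ points with a set of 3-subsets (blocks) such that each pair of distinct points lies in exactly one block; a KTS$(v)$ is an STS$(v)$ whose blocks partition into parallel classes (partitions of the point set); a subdesign is a subset of points with a subset of blocks forming an STS on that subset. -}

module Defs where

open import Data.Nat using (ℕ)
open import Data.Fin using (Fin)
open import Data.Bool using (Bool; true)
open import Data.Product using (Σ; _×_; ∃-syntax)
open import Relation.Binary.PropositionalEquality using (_≡_; _≢_)
open import Data.Fin.Subset using (Subset; _∈_; ∣_∣)

record Block (v : ℕ) : Set where
  field
    p₁ p₂ p₃ : Fin v
    d₁₂ : p₁ ≢ p₂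
    d₁₃ : p₁ ≢ p₃
    d₂₃ : p₂ ≢ p₃
open Block public

data _∈B_ {v : ℕ} (x : Fin v) (B : Block v) : Set where
  in₁ : x ≡ p₁ B → x ∈B B
  in₂ : x ≡ p₂ B → x ∈B B
  in₃ : x ≡ p₃ B → x ∈B B

∃!′ : {A : Set} → (A → Set) → Set
∃!′ {A} P = Σ A λ a → P a × (∀ a′ → P a′ → a′ ≡ a)

-- A Steiner triple system on Fin v: b blocks indexed by Fin b, such that every
-- pair of distinct points lies in exactly one block (uniqueness of the index
-- also forces the blocks to be pairwise distinct as sets).
record STS (v : ℕ) : Set where
  field
    b      : ℕ
    blocks : Fin b → Block v
    pairs  : ∀ (x y : Fin v) → x ≢ y → ∃!′ (λ i → x ∈B blocks i × y ∈B blocks i)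
open STS public

record KTS (v : ℕ) : Set where
  field
    sts   : STS v
    r     : ℕ
    class : Fin (b sts) → Fin r
    parallel : ∀ (c : Fin r) (x : Fin v) →
      ∃!′ (λ i → class i ≡ c × x ∈B blocks sts i)
open KTS public

record HasSubSTS {v : ℕ} (D : STS v) (u : ℕ) : Set where
  field
    S      : Subset v
    sizeS  : ∣ S ∣ ≡ u
    chosen : Fin (b D) → Bool
    inside : ∀ i → chosen i ≡ true → ∀ x → x ∈B blocks D i → x ∈ S
    subpairs : ∀ (x y : Fin v) → x ∈ S → y ∈ S → x ≢ y →
      ∃!′ (λ i → chosen i ≡ true × x ∈B blocks D i × y ∈B blocks D i)

-- Take the points Z₃ × V.  For every block B = {b₀, b₁, b₂} of the KTS(v) and
-- every (i, g) ∈ Z₃² form the block whose p-th point lies on level i + p·g, and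
-- add the vertical blocks Z₃ × {x}.  Two points over the same x lie only in a
-- vertical block; two points over x ≠ y at levels s, t single out the block
-- B ∋ x, y and then the unique line (i, g) of the affine plane over Z₃ through
-- (p_x, s) and (p_y, t).  A parallel class of the KTS together with a slope g
-- gives a parallel class, because for fixed p and g each level is reached by
-- exactly one intercept i; the vertical blocks form one more class.  Tripling
-- the points and blocks of a subdesign gives the subdesign of order 3u.
module Submission where

open import Defs
open import Data.Nat using (ℕ; zero; suc; _+_; _*_)
open import Data.Nat.DivMod using (_mod_)
open import Data.Fin using (Fin; zero; suc; toℕ; combine)
open import Data.Fin.Properties
  using (_≟_; all?; any?; 0≢1+n; suc-injective; +↔⊎; *↔×
        ; combine-injective; combine-injectiveˡ; combine-surjective)
open import Data.Fin.Subset using (Subset; _∈_; ∣_∣)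
open import Data.Vec using (Vec; []; _∷_; _++_; lookup; concat; replicate)
open import Data.Vec.Properties using (lookup-++ˡ; lookup-++ʳ; []=⇒lookup; lookup⇒[]=)
open import Data.Bool using (Bool; true; false)
import Data.Bool as Bool
open import Data.Product using (Σ; ∃; ∃₂; _×_; _,_; proj₂)
open import Data.Product.Properties using (≡-dec)
open import Data.Product.Function.NonDependent.Propositional using (_×-↔_)
open import Data.Sum using (_⊎_; inj₁; inj₂)
open import Data.Sum.Function.Propositional using (_⊎-↔_)
open import Data.Empty using (⊥-elim)
open import Function using (_∘_)
open import Function.Bundles using (Inverse; _↔_)
open import Function.Construct.Identity using (↔-id)
open import Function.Construct.Composition using (_↔-∘_)
open import Relation.Binary.PropositionalEquality
open import Relation.Nullary using (yes; no; ¬?; does)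
open import Relation.Nullary.Decidable using (from-yes; _×-dec_; _→-dec_)

private variable v : ℕ

∃!′-map : {A : Set} {P Q : A → Set} →
  (∀ a → P a → Q a) → (∀ a → Q a → P a) → ∃!′ P → ∃!′ Q
∃!′-map P⇒Q Q⇒P (a , Pa , unique) = a , P⇒Q a Pa , λ a′ → unique a′ ∘ Q⇒P a′

∃!′-↔ : {A B : Set} (e : A ↔ B) {P : B → Set} → ∃!′ P → ∃!′ (P ∘ Inverse.to e)
∃!′-↔ e {P} (b , Pb , unique) =
  from b , subst P (sym (strictlyInverseˡ b)) Pb ,
  λ a Pa → sym (inverseʳ (sym (unique (to a) Pa)))
  where open Inverse e

from≡⇒≡to : {A B : Set} (e : A ↔ B) {a : A} {b : B} →
  Inverse.from e b ≡ a → b ≡ Inverse.to e a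
from≡⇒≡to e {b = b} eq = trans (sym (strictlyInverseˡ b)) (cong to eq)
  where open Inverse e

Z₃ : Set
Z₃ = Fin 3

line : Z₃ → Z₃ → Z₃ → Z₃
line i g p = (toℕ i + toℕ p * toℕ g) mod 3

line-pair-surjective : ∀ p q → p ≢ q → ∀ s t → ∃₂ λ i g → line i g p ≡ s × line i g q ≡ t
line-pair-surjective = from-yes (all? λ p → all? λ q → ¬? (p ≟ q) →-dec all? λ s → all? λ t →
  any? λ i → any? λ g → line i g p ≟ s ×-dec line i g q ≟ t)

line-pair-injective : ∀ p q → p ≢ q → ∀ i g i′ g′ →
  line i g p ≡ line i′ g′ p → line i g q ≡ line i′ g′ q → (i , g) ≡ (i′ , g′)
line-pair-injective = from-yes (all? λ p → all? λ q → ¬? (p ≟ q) →-dec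
  all? λ i → all? λ g → all? λ i′ → all? λ g′ →
  line i g p ≟ line i′ g′ p →-dec line i g q ≟ line i′ g′ q →-dec
  ≡-dec _≟_ _≟_ (i , g) (i′ , g′))

line-intercept-surjective : ∀ g p s → ∃ λ i → line i g p ≡ s
line-intercept-surjective = from-yes (all? λ g → all? λ p → all? λ s → any? λ i → line i g p ≟ s)

line-intercept-injective : ∀ g p i i′ → line i g p ≡ line i′ g p → i ≡ i′
line-intercept-injective = from-yes (all? λ g → all? λ p → all? λ i → all? λ i′ →
  line i g p ≟ line i′ g p →-dec i ≟ i′)

line-through-two : ∀ {p q} → p ≢ q → ∀ s t →
  ∃!′ λ ((i , g) : Z₃ × Z₃) → line i g p ≡ s × line i g q ≡ t
line-through-two {p} {q} p≢q s t with line-pair-surjective p q p≢q s t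
... | i , g , refl , refl =
  (i , g) , (refl , refl) ,
  λ (i′ , g′) (eq-p , eq-q) → line-pair-injective p q p≢q i′ g′ i g eq-p eq-q

line-through-one : ∀ g p s → ∃!′ λ i → line i g p ≡ s
line-through-one g p s with line-intercept-surjective g p s
... | i , refl = i , refl , λ i′ eq → line-intercept-injective g p i′ i eq

lookup-concat-replicate : {A : Set} {n : ℕ} (k : ℕ) (xs : Vec A n) (i : Fin k) (j : Fin n) →
  lookup (concat (replicate k xs)) (combine i j) ≡ lookup xs j
lookup-concat-replicate (suc k) xs zero    j = lookup-++ˡ xs _ j
lookup-concat-replicate (suc k) xs (suc i) j =
  trans (lookup-++ʳ xs _ (combine i j)) (lookup-concat-replicate k xs i j)

∣p++q∣≡∣p∣+∣q∣ : ∀ {m n} (p : Subset m) (q : Subset n) → ∣ p ++ q ∣ ≡ ∣ p ∣ + ∣ q ∣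
∣p++q∣≡∣p∣+∣q∣ []      q = refl
∣p++q∣≡∣p∣+∣q∣ (x ∷ p) q with does (x Bool.≟ true)
... | true  = cong suc (∣p++q∣≡∣p∣+∣q∣ p q)
... | false = ∣p++q∣≡∣p∣+∣q∣ p q

∣concat-replicate∣ : ∀ {n} k (p : Subset n) → ∣ concat (replicate k p) ∣ ≡ k * ∣ p ∣
∣concat-replicate∣ zero    p = refl
∣concat-replicate∣ (suc k) p =
  trans (∣p++q∣≡∣p∣+∣q∣ p (concat (replicate k p))) (cong (∣ p ∣ +_) (∣concat-replicate∣ k p))

at : Block v → Z₃ → Fin v
at B zero             = p₁ B
at B (suc zero)       = p₂ B
at B (suc (suc zero)) = p₃ B

∈B⁻ : ∀ {x} {B : Block v} → x ∈B B → ∃ λ p → x ≡ at B p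
∈B⁻ (in₁ eq) = zero , eq
∈B⁻ (in₂ eq) = suc zero , eq
∈B⁻ (in₃ eq) = suc (suc zero) , eq

∈B⁺ : ∀ {x} {B : Block v} p → x ≡ at B p → x ∈B B
∈B⁺ zero             = in₁
∈B⁺ (suc zero)       = in₂
∈B⁺ (suc (suc zero)) = in₃

at-injective : ∀ (B : Block v) {p q} → at B p ≡ at B q → p ≡ q
at-injective B {zero}             {zero}             eq = refl
at-injective B {zero}             {suc zero}         eq = ⊥-elim (d₁₂ B eq)
at-injective B {zero}             {suc (suc zero)}   eq = ⊥-elim (d₁₃ B eq)
at-injective B {suc zero}         {zero}             eq = ⊥-elim (d₁₂ B (sym eq))
at-injective B {suc zero}         {suc zero}         eq = refl
at-injective B {suc zero}         {suc (suc zero)}   eq = ⊥-elim (d₂₃ B eq)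
at-injective B {suc (suc zero)}   {zero}             eq = ⊥-elim (d₁₃ B (sym eq))
at-injective B {suc (suc zero)}   {suc zero}         eq = ⊥-elim (d₂₃ B (sym eq))
at-injective B {suc (suc zero)}   {suc (suc zero)}   eq = refl

blockOf : ∀ {n} (f : Z₃ → Fin n) → (∀ {p q} → f p ≡ f q → p ≡ q) → Block n
blockOf f f-injective = record
  { p₁ = f zero ; p₂ = f (suc zero) ; p₃ = f (suc (suc zero))
  ; d₁₂ = 0≢1+n ∘ f-injective
  ; d₁₃ = 0≢1+n ∘ f-injective
  ; d₂₃ = 0≢1+n ∘ suc-injective ∘ f-injective }

tripled : Block v → Z₃ → Z₃ → Block (3 * v)
tripled B i g = blockOf (λ p → combine (line i g p) (at B p))
  (λ {p} {q} eq → at-injective B (proj₂ (combine-injective (line i g p) _ (line i g q) _ eq)))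

vertical : Fin v → Block (3 * v)
vertical x = blockOf (λ l → combine l x) (λ {l} {l′} → combine-injectiveˡ l x l′ x)

at-tripled : ∀ (B : Block v) i g p → at (tripled B i g) p ≡ combine (line i g p) (at B p)
at-tripled B i g zero             = refl
at-tripled B i g (suc zero)       = refl
at-tripled B i g (suc (suc zero)) = refl

at-vertical : ∀ (x : Fin v) l → at (vertical x) l ≡ combine l x
at-vertical x zero             = refl
at-vertical x (suc zero)       = refl
at-vertical x (suc (suc zero)) = refl

∈-tripled⁻ : ∀ (B : Block v) i g l x →
  combine l x ∈B tripled B i g → ∃ λ p → l ≡ line i g p × x ≡ at B p
∈-tripled⁻ B i g l x l,x∈ with ∈B⁻ l,x∈
... | p , eq = p , combine-injective _ _ _ _ (trans eq (at-tripled B i g p))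

∈-tripled⁺ : ∀ (B : Block v) i g {l x} p →
  l ≡ line i g p → x ≡ at B p → combine l x ∈B tripled B i g
∈-tripled⁺ B i g p refl refl = ∈B⁺ p (sym (at-tripled B i g p))

∈-vertical⁻ : ∀ (y : Fin v) (l : Z₃) x → combine l x ∈B vertical y → x ≡ y
∈-vertical⁻ y l x l,x∈ with ∈B⁻ l,x∈
... | l′ , eq = proj₂ (combine-injective l x l′ y (trans eq (at-vertical y l′)))

∈-vertical⁺ : ∀ (l : Z₃) (x : Fin v) → combine l x ∈B vertical x
∈-vertical⁺ l x = ∈B⁺ l (sym (at-vertical x l))

module Tripling {v : ℕ} (D : STS v) where

  Index : Set
  Index = (Fin (b D) × Z₃ × Z₃) ⊎ Fin v

  index↔ : Fin (b D * (3 * 3) + v) ↔ Index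
  index↔ = ((↔-id _ ×-↔ *↔×) ↔-∘ *↔× ⊎-↔ ↔-id _) ↔-∘ +↔⊎

  block : Index → Block (3 * v)
  block (inj₁ (β , i , g)) = tripled (blocks D β) i g
  block (inj₂ x)           = vertical x

  selected : (Fin (b D) → Bool) → (Fin v → Bool) → Index → Bool
  selected keep keepV (inj₁ (β , _)) = keep β
  selected keep keepV (inj₂ x)       = keepV x

  module Selection (keep : Fin (b D) → Bool) (keepV : Fin v → Bool) where

    Covers : Fin (3 * v) → Fin (3 * v) → Index → Set
    Covers z w d = selected keep keepV d ≡ true × z ∈B block d × w ∈B block d

    same-base-pair : ∀ (l m : Z₃) x → l ≢ m → keepV x ≡ true →
      ∃!′ (Covers (combine l x) (combine m x))
    same-base-pair l m x l≢m keep-x =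
      inj₂ x , (keep-x , ∈-vertical⁺ l x , ∈-vertical⁺ m x) , unique
      where
      unique : ∀ d → Covers (combine l x) (combine m x) d → d ≡ inj₂ x
      unique (inj₂ y) (_ , l,x∈ , _) = cong inj₂ (sym (∈-vertical⁻ y l x l,x∈))
      unique (inj₁ (β , i , g)) (_ , l,x∈ , m,x∈)
        with ∈-tripled⁻ (blocks D β) i g l x l,x∈ | ∈-tripled⁻ (blocks D β) i g m x m,x∈
      ... | p , l≡ , x≡ | q , m≡ , x≡′ with at-injective (blocks D β) {p} {q} (trans (sym x≡) x≡′)
      ... | refl = ⊥-elim (l≢m (trans l≡ (sym m≡)))

    distinct-base-pair : ∀ (l m : Z₃) {x y} → x ≢ y →
      ∃!′ (λ β → keep β ≡ true × x ∈B blocks D β × y ∈B blocks D β) →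
      ∃!′ (Covers (combine l x) (combine m y))
    distinct-base-pair l m {x} {y} x≢y (β , (keep-β , x∈ , y∈) , unique-β)
      with ∈B⁻ x∈ | ∈B⁻ y∈
    ... | p , x≡ | q , y≡ with line-through-two p≢q l m
      where
      p≢q : p ≢ q
      p≢q refl = x≢y (trans x≡ (sym y≡))
    ... | (i , g) , (l≡ , m≡) , unique-ig =
      inj₁ (β , i , g) ,
      (keep-β , ∈-tripled⁺ (blocks D β) i g p (sym l≡) x≡ ,
                ∈-tripled⁺ (blocks D β) i g q (sym m≡) y≡) ,
      unique
      where
      unique : ∀ d → Covers (combine l x) (combine m y) d → d ≡ inj₁ (β , i , g)
      unique (inj₂ z) (_ , l,x∈ , m,y∈) =
        ⊥-elim (x≢y (trans (∈-vertical⁻ z l x l,x∈) (sym (∈-vertical⁻ z m y m,y∈))))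
      unique (inj₁ (β′ , i′ , g′)) (keep-β′ , l,x∈ , m,y∈)
        with ∈-tripled⁻ (blocks D β′) i′ g′ l x l,x∈ | ∈-tripled⁻ (blocks D β′) i′ g′ m y m,y∈
      ... | p′ , l≡′ , x≡′ | q′ , m≡′ , y≡′ with unique-β β′ (keep-β′ , ∈B⁺ p′ x≡′ , ∈B⁺ q′ y≡′)
      ... | refl with at-injective (blocks D β) {p′} {p} (trans (sym x≡′) x≡)
                    | at-injective (blocks D β) {q′} {q} (trans (sym y≡′) y≡)
      ... | refl | refl = cong (λ ig → inj₁ (β , ig)) (unique-ig (i′ , g′) (sym l≡′ , sym m≡′))

    KeptBase : Fin (3 * v) → Set
    KeptBase z = ∀ (l : Z₃) x → combine l x ≡ z → keepV x ≡ true

    covering-block :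
      (∀ x y → keepV x ≡ true → keepV y ≡ true → x ≢ y →
         ∃!′ λ β → keep β ≡ true × x ∈B blocks D β × y ∈B blocks D β) →
      ∀ z w → z ≢ w → KeptBase z → KeptBase w → ∃!′ (Covers z w)
    covering-block base-pairs z w z≢w kept-z kept-w
      with combine-surjective {3} {v} z | combine-surjective {3} {v} w
    ... | l , x , refl | m , y , refl with x ≟ y
    ... | yes refl =
      same-base-pair l m x (λ l≡m → z≢w (cong (λ l → combine l x) l≡m)) (kept-z l x refl)
    ... | no x≢y =
      distinct-base-pair l m x≢y (base-pairs x y (kept-z l x refl) (kept-w m y refl) x≢y)

  open Selection

  all-selected : ∀ d → selected (λ _ → true) (λ _ → true) d ≡ true
  all-selected (inj₁ _) = refl
  all-selected (inj₂ _) = refl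

  tripledSTS : STS (3 * v)
  tripledSTS = record
    { b      = b D * (3 * 3) + v
    ; blocks = block ∘ Inverse.to index↔
    ; pairs  = λ z w z≢w → ∃!′-↔ index↔ (∃!′-map (λ _ → proj₂) (λ d → all-selected d ,_)
        (covering-block (λ _ → true) (λ _ → true)
          (λ x y _ _ x≢y → ∃!′-map (λ _ → refl ,_) (λ _ → proj₂) (pairs D x y x≢y))
          z w z≢w (λ _ _ _ → refl) (λ _ _ _ → refl)))
    }

  ClassIndex : ℕ → Set
  ClassIndex r = (Fin r × Z₃) ⊎ Fin 1

  class↔ : ∀ r → Fin (r * 3 + 1) ↔ ClassIndex r
  class↔ r = (*↔× ⊎-↔ ↔-id _) ↔-∘ +↔⊎

  classOf : ∀ {r} → (Fin (b D) → Fin r) → Index → ClassIndex r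
  classOf cls (inj₁ (β , _ , g)) = inj₁ (cls β , g)
  classOf cls (inj₂ _)           = inj₂ zero

  module _ {r} (cls : Fin (b D) → Fin r)
           (parallel-D : ∀ c x → ∃!′ λ β → cls β ≡ c × x ∈B blocks D β) where

    parallel-tripled : ∀ c z → ∃!′ λ d → classOf cls d ≡ c × z ∈B block d
    parallel-tripled (inj₂ zero) z with combine-surjective {3} {v} z
    ... | l , x , refl = inj₂ x , (refl , ∈-vertical⁺ l x) , unique
      where
      unique : ∀ d → classOf cls d ≡ inj₂ zero × combine l x ∈B block d → d ≡ inj₂ x
      unique (inj₁ _) (() , _)
      unique (inj₂ y) (_ , l,x∈) = cong inj₂ (sym (∈-vertical⁻ y l x l,x∈))
    parallel-tripled (inj₁ (κ , g)) z with combine-surjective {3} {v} z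
    ... | l , x , refl with parallel-D κ x
    ... | β , (cls-β , x∈) , unique-β with ∈B⁻ x∈
    ... | p , x≡ with line-through-one g p l
    ... | i , l≡ , unique-i =
      inj₁ (β , i , g) ,
      (cong (λ c → inj₁ (c , g)) cls-β , ∈-tripled⁺ (blocks D β) i g p (sym l≡) x≡) ,
      unique
      where
      unique : ∀ d → classOf cls d ≡ inj₁ (κ , g) × combine l x ∈B block d → d ≡ inj₁ (β , i , g)
      unique (inj₂ _) (() , _)
      unique (inj₁ (β′ , i′ , g′)) (refl , l,x∈) with ∈-tripled⁻ (blocks D β′) i′ g′ l x l,x∈
      ... | p′ , l≡′ , x≡′ with unique-β β′ (refl , ∈B⁺ p′ x≡′)
      ... | refl with at-injective (blocks D β) {p′} {p} (trans (sym x≡′) x≡)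
      ... | refl = cong (λ i → inj₁ (β , i , g)) (unique-i i′ (sym l≡′))

    tripledKTS : KTS (3 * v)
    tripledKTS = record
      { sts      = tripledSTS
      ; r        = r * 3 + 1
      ; class    = Inverse.from (class↔ r) ∘ classOf cls ∘ Inverse.to index↔
      ; parallel = λ c z → ∃!′-↔ index↔
          (∃!′-map (λ _ (eq , z∈) → Inverse.inverseʳ (class↔ r) eq , z∈)
                   (λ _ (eq , z∈) → from≡⇒≡to (class↔ r) eq , z∈)
                   (parallel-tripled (Inverse.to (class↔ r) c) z))
      }

  module _ {u} (H : HasSubSTS D u) where
    open HasSubSTS H

    tripledSet : Subset (3 * v)
    tripledSet = concat (replicate 3 S)

    ∈-tripledSet⁻ : ∀ {z} → z ∈ tripledSet → KeptBase chosen (lookup S) z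
    ∈-tripledSet⁻ z∈ l x refl = trans (sym (lookup-concat-replicate 3 S l x)) ([]=⇒lookup z∈)

    ∈-tripledSet⁺ : ∀ (l : Z₃) x → x ∈ S → combine l x ∈ tripledSet
    ∈-tripledSet⁺ l x x∈ =
      lookup⇒[]= _ tripledSet (trans (lookup-concat-replicate 3 S l x) ([]=⇒lookup x∈))

    tripledSub : HasSubSTS tripledSTS (3 * u)
    tripledSub = record
      { S        = tripledSet
      ; sizeS    = trans (∣concat-replicate∣ 3 S) (cong (3 *_) sizeS)
      ; chosen   = selected chosen (lookup S) ∘ Inverse.to index↔
      ; inside   = λ t → selected⇒inside (Inverse.to index↔ t)
      ; subpairs = λ z w z∈ w∈ z≢w → ∃!′-↔ index↔
          (covering-block chosen (lookup S)
            (λ x y x∈ y∈ → subpairs x y (lookup⇒[]= x S x∈) (lookup⇒[]= y S y∈))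
            z w z≢w (∈-tripledSet⁻ z∈) (∈-tripledSet⁻ w∈))
      }
      where
      selected⇒inside : ∀ d → selected chosen (lookup S) d ≡ true →
        ∀ z → z ∈B block d → z ∈ tripledSet
      selected⇒inside (inj₁ (β , i , g)) chosen-β z z∈ with combine-surjective {3} {v} z
      ... | l , x , refl with ∈-tripled⁻ (blocks D β) i g l x z∈
      ... | p , _ , x≡ = ∈-tripledSet⁺ l x (inside β chosen-β x (∈B⁺ p x≡))
      selected⇒inside (inj₂ y) y∈S z z∈ with combine-surjective {3} {v} z
      ... | l , x , refl =
        ∈-tripledSet⁺ l x (subst (_∈ S) (sym (∈-vertical⁻ y l x z∈)) (lookup⇒[]= y S y∈S))

proposition4p7 : ∀ (u v : ℕ) →
    Σ (KTS v) (λ K → HasSubSTS (sts K) u) →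
    Σ (KTS (3 * v)) (λ K → HasSubSTS (sts K) (3 * u))
proposition4p7 u v (K , H) = tripledKTS (class K) (parallel K) , tripledSub H
  where open Tripling (sts K)
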